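{- For all positive integers $n$ and $\ell$, $\mathcal D(n,2^\ell)\le 2^\ell-1$.
   Context: $\mathsf{Ham}(x)$ is the Hamming weight of $x\in\mathbb F_2^n$. $\mathcal D(n,M)$ denotes the largest dimension of an affine subspace $C$ of $\mathbb F_2^n$ such that for some $0\le a\le M$ there exists exactly one point $x_0\in C$ with $\mathsf{Ham}(x_0)\equiv a\pmod M$. -}

module Defs where

open import Data.Bool using (Bool; true; false; if_then_else_; _xor_)
open import Data.Nat using (ℕ; zero; suc; _+_; _*_; _≤_; _^_; _∸_)
open import Data.Vec using (Vec; []; _∷_; replicate; zipWith)
open import Data.Sum using (_⊎_)
open import Data.Product using (Σ; ∃; _×_; _,_)
open import Relation.Binary.PropositionalEquality using (_≡_)

F₂^ : ℕ → Set
F₂^ n = Vec Bool n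

_⊕_ : ∀ {n} → F₂^ n → F₂^ n → F₂^ n
_⊕_ = zipWith _xor_

𝟎 : ∀ {n} → F₂^ n
𝟎 = replicate _ false

Ham : ∀ {n} → F₂^ n → ℕ
Ham [] = 0
Ham (true ∷ xs) = suc (Ham xs)
Ham (false ∷ xs) = Ham xs

lincomb : ∀ {n d} → Vec Bool d → Vec (F₂^ n) d → F₂^ n
lincomb [] [] = 𝟎
lincomb (c ∷ cs) (v ∷ vs) = if c then v ⊕ lincomb cs vs else lincomb cs vs

LinIndep : ∀ {n d} → Vec (F₂^ n) d → Set
LinIndep {d = d} vs = (c : Vec Bool d) → lincomb c vs ≡ 𝟎 → c ≡ 𝟎

record AffineSubspace (n d : ℕ) : Set where
  constructor affine
  field
    base : F₂^ n
    dirs : Vec (F₂^ n) d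
    indep : LinIndep dirs

_∈A_ : ∀ {n d} → F₂^ n → AffineSubspace n d → Set
x ∈A C = ∃ λ (c : Vec Bool _) → x ≡ AffineSubspace.base C ⊕ lincomb c (AffineSubspace.dirs C)

_≡_[mod_] : ℕ → ℕ → ℕ → Set
x ≡ y [mod M ] = (∃ λ k → x ≡ y + k * M) ⊎ (∃ λ k → y ≡ x + k * M)

UniqueResidue : ∀ {n d} → AffineSubspace n d → (M a : ℕ) → Set
UniqueResidue C M a = Σ _ λ x₀ → (x₀ ∈A C × Ham x₀ ≡ a [mod M ])
  × (∀ y → y ∈A C → Ham y ≡ a [mod M ] → y ≡ x₀)

module Submission where

-- Let hits y test Ham y ≡ a (mod 2^ℓ). The ℓ low bits of Ham y are produced by a ripple-carry
-- counter over the coordinates of y, and bit i has algebraic degree at most 2^i: the carry into it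
-- is a conjunction of the input bit with bits of degree 1, 2, …, 2^(i-1). Comparing all ℓ bits with
-- those of a is one more conjunction, so hits has degree at most 1 + 2 + ⋯ + 2^(ℓ-1) = 2^ℓ − 1.
-- A Boolean function of degree below d sums to 0 over every d-dimensional affine subspace, whereas
-- hits sums to 1 over a subspace meeting the residue class in exactly one point.

open import Defs
open import Algebra.Bundles using (CommutativeRing)
open import Data.Bool using (Bool; true; false; not; _∧_; _xor_)
open import Data.Bool.Properties
  using (xor-assoc; xor-comm; xor-same; xor-identityˡ; xor-identityʳ; ∧-comm; ∧-distribˡ-xor; ∧-distribʳ-xor;
         ¬-not; xor-∧-commutativeRing)
open import Algebra.Properties.CommutativeSemigroup
  (CommutativeRing.+-commutativeSemigroup xor-∧-commutativeRing) using (interchange)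
open import Data.Nat using (ℕ; zero; suc; _+_; _*_; _≤_; _<_; _^_; _∸_; z≤n; s≤s; NonZero)
open import Data.Nat.DivMod using (_%_; _/_; m≡m%n+[m/n]*n; m%n<n)
open import Data.Nat.GeneralisedArithmetic using (fold; fold-+)
open import Data.Nat.Properties
  using (+-assoc; +-comm; +-suc; +-identityʳ; *-suc; *-identityˡ; *-identityʳ; *-distribʳ-+;
         ≤-total; ≮⇒≥; <-irrefl; <-trans; n<1+n; m+[n∸m]≡n; m+n∸n≡m; m^n≢0)
open import Data.Nat.Tactic.RingSolver using (solve-∀)
open import Data.Empty using (⊥-elim)
open import Data.Product using (∃; _×_; _,_)
open import Data.Sum using (inj₁; inj₂; _⊎_)
open import Data.Unit using (⊤; tt)
open import Data.Vec using (Vec; []; _∷_; replicate; head; tail)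
open import Data.Vec.Properties
  using (zipWith-assoc; zipWith-comm; zipWith-identityˡ; zipWith-identityʳ; ∷-injectiveʳ)
open import Function using (_∘_)
open import Relation.Binary.PropositionalEquality
open ≡-Reasoning

⊕-assoc : ∀ {n} (x y z : F₂^ n) → (x ⊕ y) ⊕ z ≡ x ⊕ (y ⊕ z)
⊕-assoc = zipWith-assoc xor-assoc

⊕-comm : ∀ {n} (x y : F₂^ n) → x ⊕ y ≡ y ⊕ x
⊕-comm = zipWith-comm xor-comm

⊕-identityˡ : ∀ {n} (x : F₂^ n) → 𝟎 ⊕ x ≡ x
⊕-identityˡ = zipWith-identityˡ xor-identityˡ

⊕-identityʳ : ∀ {n} (x : F₂^ n) → x ⊕ 𝟎 ≡ x
⊕-identityʳ = zipWith-identityʳ xor-identityʳ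

⊕-self : ∀ {n} (x : F₂^ n) → x ⊕ x ≡ 𝟎
⊕-self [] = refl
⊕-self (a ∷ x) = cong₂ _∷_ (xor-same a) (⊕-self x)

⊕-cancelˡ : ∀ {n} (x y : F₂^ n) → x ⊕ (x ⊕ y) ≡ y
⊕-cancelˡ x y = begin
  x ⊕ (x ⊕ y)  ≡⟨ ⊕-assoc x x y ⟨
  (x ⊕ x) ⊕ y  ≡⟨ cong (_⊕ y) (⊕-self x) ⟩
  𝟎 ⊕ y        ≡⟨ ⊕-identityˡ y ⟩
  y            ∎

⊕-swapʳ : ∀ {n} (x y z : F₂^ n) → (x ⊕ y) ⊕ z ≡ (x ⊕ z) ⊕ y
⊕-swapʳ x y z = begin
  (x ⊕ y) ⊕ z  ≡⟨ ⊕-assoc x y z ⟩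
  x ⊕ (y ⊕ z)  ≡⟨ cong (x ⊕_) (⊕-comm y z) ⟩
  x ⊕ (z ⊕ y)  ≡⟨ ⊕-assoc x z y ⟨
  (x ⊕ z) ⊕ y  ∎

⊕-interchange : ∀ {n} (w x y z : F₂^ n) → (w ⊕ x) ⊕ (y ⊕ z) ≡ (w ⊕ y) ⊕ (x ⊕ z)
⊕-interchange [] [] [] [] = refl
⊕-interchange (a ∷ w) (b ∷ x) (c ∷ y) (d ∷ z) =
  cong₂ _∷_ (interchange a b c d) (⊕-interchange w x y z)

lincomb-⊕ : ∀ {n d} (c c′ : Vec Bool d) (vs : Vec (F₂^ n) d) →
            lincomb (c ⊕ c′) vs ≡ lincomb c vs ⊕ lincomb c′ vs
lincomb-⊕ [] [] [] = sym (⊕-self 𝟎)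
lincomb-⊕ (false ∷ c) (false ∷ c′) (v ∷ vs) = lincomb-⊕ c c′ vs
lincomb-⊕ (true ∷ c) (false ∷ c′) (v ∷ vs) =
  trans (cong (v ⊕_) (lincomb-⊕ c c′ vs)) (sym (⊕-assoc v _ _))
lincomb-⊕ (false ∷ c) (true ∷ c′) (v ∷ vs) = begin
  v ⊕ lincomb (c ⊕ c′) vs                ≡⟨ cong (v ⊕_) (lincomb-⊕ c c′ vs) ⟩
  v ⊕ (lincomb c vs ⊕ lincomb c′ vs)     ≡⟨ ⊕-assoc v _ _ ⟨
  (v ⊕ lincomb c vs) ⊕ lincomb c′ vs     ≡⟨ cong (_⊕ lincomb c′ vs) (⊕-comm v _) ⟩
  (lincomb c vs ⊕ v) ⊕ lincomb c′ vs     ≡⟨ ⊕-assoc _ v _ ⟩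
  lincomb c vs ⊕ (v ⊕ lincomb c′ vs)     ∎
lincomb-⊕ (true ∷ c) (true ∷ c′) (v ∷ vs) = begin
  lincomb (c ⊕ c′) vs                             ≡⟨ lincomb-⊕ c c′ vs ⟩
  lincomb c vs ⊕ lincomb c′ vs                    ≡⟨ ⊕-identityˡ _ ⟨
  𝟎 ⊕ (lincomb c vs ⊕ lincomb c′ vs)              ≡⟨ cong (_⊕ _) (⊕-self v) ⟨
  (v ⊕ v) ⊕ (lincomb c vs ⊕ lincomb c′ vs)        ≡⟨ ⊕-interchange v v _ _ ⟩
  (v ⊕ lincomb c vs) ⊕ (v ⊕ lincomb c′ vs)        ∎

lincomb-injective : ∀ {n d} {vs : Vec (F₂^ n) d} → LinIndep vs →
                    ∀ {c c′} → lincomb c vs ≡ lincomb c′ vs → c ≡ c′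
lincomb-injective {vs = vs} indep {c} {c′} eq = begin
  c               ≡⟨ ⊕-identityʳ c ⟨
  c ⊕ 𝟎           ≡⟨ cong (c ⊕_) (indep (c ⊕ c′) c⊕c′↦𝟎) ⟨
  c ⊕ (c ⊕ c′)    ≡⟨ ⊕-cancelˡ c c′ ⟩
  c′              ∎
  where
  c⊕c′↦𝟎 : lincomb (c ⊕ c′) vs ≡ 𝟎
  c⊕c′↦𝟎 = trans (lincomb-⊕ c c′ vs) (trans (cong (_⊕ lincomb c′ vs) eq) (⊕-self _))

point-injective : ∀ {n d} {b : F₂^ n} {vs : Vec (F₂^ n) d} → LinIndep vs →
                  ∀ {c c′} → b ⊕ lincomb c vs ≡ b ⊕ lincomb c′ vs → c ≡ c′
point-injective {b = b} indep eq =
  lincomb-injective indep (trans (sym (⊕-cancelˡ b _)) (trans (cong (b ⊕_) eq) (⊕-cancelˡ b _)))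

Δ : ∀ {n} → F₂^ n → (F₂^ n → Bool) → F₂^ n → Bool
Δ v f x = f (x ⊕ v) xor f x

-- f has algebraic degree < k iff all its k-fold derivatives vanish.
Deg< : ∀ {n} → ℕ → (F₂^ n → Bool) → Set
Deg< zero f = ∀ x → f x ≡ false
Deg< (suc k) f = ∀ v → Deg< k (Δ v f)

Deg : ∀ {n} → ℕ → (F₂^ n → Bool) → Set
Deg k = Deg< (suc k)

Deg<-cong : ∀ {n} k {f g : F₂^ n → Bool} → f ≗ g → Deg< k f → Deg< k g
Deg<-cong zero f≗g d x = trans (sym (f≗g x)) (d x)
Deg<-cong (suc k) f≗g d v = Deg<-cong k (λ x → cong₂ _xor_ (f≗g _) (f≗g x)) (d v)

Deg<-suc : ∀ {n} k {f : F₂^ n → Bool} → Deg< k f → Deg< (suc k) f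
Deg<-suc zero d v x = cong₂ _xor_ (d (x ⊕ v)) (d x)
Deg<-suc (suc k) d v = Deg<-suc k (d v)

Deg<-mono : ∀ {n j k} {f : F₂^ n → Bool} → j ≤ k → Deg< j f → Deg< k f
Deg<-mono {k = zero} z≤n d = d
Deg<-mono {k = suc k} z≤n d = Deg<-suc k (Deg<-mono z≤n d)
Deg<-mono (s≤s j≤k) d v = Deg<-mono j≤k (d v)

Deg<-xor : ∀ {n} k {f g : F₂^ n → Bool} → Deg< k f → Deg< k g → Deg< k (λ x → f x xor g x)
Deg<-xor zero df dg x = cong₂ _xor_ (df x) (dg x)
Deg<-xor (suc k) {f} {g} df dg v =
  Deg<-cong k (λ x → interchange (f (x ⊕ v)) (f x) (g (x ⊕ v)) (g x)) (Deg<-xor k (df v) (dg v))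

Affine : ∀ {m n} → (F₂^ m → F₂^ n) → Set
Affine L = ∀ v → ∃ λ w → ∀ x → L (x ⊕ v) ≡ L x ⊕ w

Deg<-∘ : ∀ {m n} k {f : F₂^ n → Bool} {L : F₂^ m → F₂^ n} → Affine L → Deg< k f → Deg< k (f ∘ L)
Deg<-∘ zero {L = L} _ d x = d (L x)
Deg<-∘ (suc k) {f} {L} affine-L d v with affine-L v
... | w , L-shift =
  Deg<-cong k (λ x → cong (λ y → f y xor f (L x)) (sym (L-shift x))) (Deg<-∘ k affine-L (d w))

translation-affine : ∀ {n} (u : F₂^ n) → Affine (_⊕ u)
translation-affine u v = v , λ x → ⊕-swapʳ x v u

tail-affine : ∀ {n} → Affine {suc n} {n} tail
tail-affine (_ ∷ v) = v , λ { (_ ∷ _) → refl }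

Deg-const : ∀ {n} k (b : Bool) → Deg {n} k (λ _ → b)
Deg-const k b = Deg<-mono {f = λ _ → b} (s≤s z≤n) λ _ _ → xor-same b

xor≡false⇒≡ : ∀ {a b} → a xor b ≡ false → a ≡ b
xor≡false⇒≡ {false} {false} _ = refl
xor≡false⇒≡ {false} {true} ()
xor≡false⇒≡ {true} {false} ()
xor≡false⇒≡ {true} {true} _ = refl

xor-cancelˡ : ∀ a b → a xor (a xor b) ≡ b
xor-cancelˡ a b = trans (sym (xor-assoc a a b)) (cong (_xor b) (xor-same a))

Deg0⇒constant : ∀ {n} {f : F₂^ n → Bool} → Deg 0 f → ∀ x → f x ≡ f 𝟎
Deg0⇒constant {f = f} d x = trans (cong f (sym (⊕-identityˡ x))) (xor≡false⇒≡ (d x 𝟎))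

Deg-head : ∀ {n} → Deg {suc n} 1 head
Deg-head (a ∷ _) = Deg<-cong 1 Δ-head≗a (Deg-const 0 a)
  where
  Δ-head≗a : (λ _ → a) ≗ Δ (a ∷ _) head
  Δ-head≗a (b ∷ _) = sym (trans (xor-comm (b xor a) b) (xor-cancelˡ b a))

-- The Leibniz rule for Δ v (f ∧ g), with a, b the values of f, g at x ⊕ v and c, d those at x.
∧-leibniz : ∀ a b c d → (a ∧ b) xor (c ∧ d) ≡ ((a xor c) ∧ b) xor (c ∧ (b xor d))
∧-leibniz a b c d = sym (begin
  ((a xor c) ∧ b) xor (c ∧ (b xor d))               ≡⟨ cong₂ _xor_ (∧-distribʳ-xor b a c) (∧-distribˡ-xor c b d) ⟩
  ((a ∧ b) xor (c ∧ b)) xor ((c ∧ b) xor (c ∧ d))   ≡⟨ xor-assoc (a ∧ b) _ _ ⟩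
  (a ∧ b) xor ((c ∧ b) xor ((c ∧ b) xor (c ∧ d)))   ≡⟨ cong ((a ∧ b) xor_) (xor-cancelˡ (c ∧ b) (c ∧ d)) ⟩
  (a ∧ b) xor (c ∧ d)                               ∎)

Deg-∧ : ∀ {n} j k {f g : F₂^ n → Bool} → Deg j f → Deg k g → Deg (j + k) (λ x → f x ∧ g x)
Deg-∧ zero k {f} {g} df dg =
  Deg<-cong (suc k) (λ x → cong (_∧ g x) (sym (Deg0⇒constant {f = f} df x))) (const∧ (f 𝟎))
  where
  const∧ : ∀ b → Deg k (λ x → b ∧ g x)
  const∧ true = dg
  const∧ false = Deg-const k false
Deg-∧ (suc j) zero {f} {g} df dg =
  subst (λ i → Deg i (λ x → f x ∧ g x)) (sym (+-identityʳ (suc j)))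
    (Deg<-cong (suc (suc j)) (λ x → ∧-comm (g x) (f x)) (Deg-∧ zero (suc j) {g} {f} dg df))
Deg-∧ (suc j) (suc k) {f} {g} df dg v =
  Deg<-cong (suc (j + suc k))
    (λ x → sym (∧-leibniz (f (x ⊕ v)) (g (x ⊕ v)) (f x) (g x)))
    (Deg<-xor (suc (j + suc k)) {λ x → Δ v f x ∧ g (x ⊕ v)} {λ x → f x ∧ Δ v g x}
      (Deg-∧ j (suc k) {Δ v f} {g ∘ (_⊕ v)} (df v)
        (Deg<-∘ (suc (suc k)) {g} (translation-affine v) dg))
      (subst (λ i → Deg i (λ x → f x ∧ Δ v g x)) (sym (+-suc j k))
        (Deg-∧ (suc j) k {f} {Δ v g} df (dg v))))

∑ : (m : ℕ) → (F₂^ m → Bool) → Bool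
∑ zero g = g []
∑ (suc m) g = ∑ m (λ c → g (true ∷ c)) xor ∑ m (λ c → g (false ∷ c))

∑-cong : ∀ m {g h : F₂^ m → Bool} → g ≗ h → ∑ m g ≡ ∑ m h
∑-cong zero g≗h = g≗h []
∑-cong (suc m) g≗h = cong₂ _xor_ (∑-cong m (g≗h ∘ (true ∷_))) (∑-cong m (g≗h ∘ (false ∷_)))

∑-xor : ∀ m (g h : F₂^ m → Bool) → ∑ m (λ c → g c xor h c) ≡ ∑ m g xor ∑ m h
∑-xor zero g h = refl
∑-xor (suc m) g h =
  trans (cong₂ _xor_ (∑-xor m _ _) (∑-xor m _ _))
        (interchange (∑ m (g ∘ (true ∷_))) (∑ m (h ∘ (true ∷_)))
                     (∑ m (g ∘ (false ∷_))) (∑ m (h ∘ (false ∷_))))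

∑-false : ∀ m {g : F₂^ m → Bool} → (∀ c → g c ≡ false) → ∑ m g ≡ false
∑-false zero g≡false = g≡false []
∑-false (suc m) g≡false =
  cong₂ _xor_ (∑-false m (g≡false ∘ (true ∷_))) (∑-false m (g≡false ∘ (false ∷_)))

∑-unique : ∀ m {g : F₂^ m → Bool} c₀ → g c₀ ≡ true → (∀ c → g c ≡ true → c ≡ c₀) → ∑ m g ≡ true
∑-unique zero [] gc₀ _ = gc₀
∑-unique (suc m) (true ∷ c₀) gc₀ only-c₀ =
  cong₂ _xor_ (∑-unique m c₀ gc₀ (λ c gc → ∷-injectiveʳ (only-c₀ _ gc)))
              (∑-false m (λ c → ¬-not (λ gc → case-false (only-c₀ _ gc))))
  where
  case-false : ∀ {c} → false ∷ c ≢ true ∷ c₀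
  case-false ()
∑-unique (suc m) (false ∷ c₀) gc₀ only-c₀ =
  cong₂ _xor_ (∑-false m (λ c → ¬-not (λ gc → case-true (only-c₀ _ gc))))
              (∑-unique m c₀ gc₀ (λ c gc → ∷-injectiveʳ (only-c₀ _ gc)))
  where
  case-true : ∀ {c} → true ∷ c ≢ false ∷ c₀
  case-true ()

-- The direction v pairs each point y with y ⊕ v, turning the sum of f into a sum of Δ v f
-- over one dimension less.
∑-affine-vanishes : ∀ {n} m {f : F₂^ n → Bool} → Deg< m f → ∀ x (vs : Vec (F₂^ n) m) →
                    ∑ m (λ c → f (x ⊕ lincomb c vs)) ≡ false
∑-affine-vanishes zero d x [] = d (x ⊕ 𝟎)
∑-affine-vanishes (suc m) {f} d x (v ∷ vs) = begin
  ∑ m (λ c → f (x ⊕ (v ⊕ lincomb c vs))) xor ∑ m (λ c → f (x ⊕ lincomb c vs))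
    ≡⟨ ∑-xor m _ _ ⟨
  ∑ m (λ c → f (x ⊕ (v ⊕ lincomb c vs)) xor f (x ⊕ lincomb c vs))
    ≡⟨ ∑-cong m (λ c → cong (λ y → f y xor f (x ⊕ lincomb c vs)) (pair c)) ⟩
  ∑ m (λ c → Δ v f (x ⊕ lincomb c vs))
    ≡⟨ ∑-affine-vanishes m (d v) x vs ⟩
  false ∎
  where
  pair : ∀ c → x ⊕ (v ⊕ lincomb c vs) ≡ (x ⊕ lincomb c vs) ⊕ v
  pair c = trans (sym (⊕-assoc x v _)) (⊕-swapʳ x v _)

dim≤deg : ∀ {n m k} {f : F₂^ n → Bool} {x} {vs : Vec (F₂^ n) m} → Deg k f →
          ∀ c₀ → f (x ⊕ lincomb c₀ vs) ≡ true → (∀ c → f (x ⊕ lincomb c vs) ≡ true → c ≡ c₀) → m ≤ k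
dim≤deg {m = m} {f = f} {x} {vs} d c₀ fc₀ only-c₀ = ≮⇒≥ λ k<m →
  true≢false (trans (sym (∑-unique m c₀ fc₀ only-c₀))
                    (∑-affine-vanishes m (Deg<-mono {f = f} k<m d) x vs))
  where
  true≢false : true ≢ false
  true≢false ()

-- Adds a carry bit to a little-endian binary number, dropping the overflow. It looks at the number
-- only through head and tail, so that the bits of λ y → addCarry (c y) (F y) unfold for an arbitrary F.
addCarry : ∀ {ℓ} → Bool → Vec Bool ℓ → Vec Bool ℓ
addCarry {zero} c bs = []
addCarry {suc ℓ} c bs = (head bs xor c) ∷ addCarry (c ∧ head bs) (tail bs)

addCarry-false : ∀ {ℓ} (bs : Vec Bool ℓ) → addCarry false bs ≡ bs
addCarry-false [] = refl
addCarry-false (b ∷ bs) = cong₂ _∷_ (xor-identityʳ b) (addCarry-false bs)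

hamBits : ∀ {n ℓ} → F₂^ n → Vec Bool ℓ
hamBits [] = replicate _ false
hamBits (b ∷ y) = addCarry b (hamBits y)

-- The i-th bit of F y has degree at most 2ⁱ s.
BitDeg : ∀ {n} → ℕ → (ℓ : ℕ) → (F₂^ n → Vec Bool ℓ) → Set
BitDeg s zero F = ⊤
BitDeg s (suc ℓ) F = Deg s (head ∘ F) × BitDeg (s + s) ℓ (tail ∘ F)

BitDeg-cong : ∀ {n} s ℓ {F G : F₂^ n → Vec Bool ℓ} → F ≗ G → BitDeg s ℓ F → BitDeg s ℓ G
BitDeg-cong s zero _ _ = tt
BitDeg-cong s (suc ℓ) F≗G (d , ds) =
  Deg<-cong (suc s) (cong head ∘ F≗G) d , BitDeg-cong (s + s) ℓ (cong tail ∘ F≗G) ds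

BitDeg-const : ∀ {n} s ℓ (bs : Vec Bool ℓ) → BitDeg {n} s ℓ (λ _ → bs)
BitDeg-const s zero bs = tt
BitDeg-const s (suc ℓ) bs = Deg-const s (head bs) , BitDeg-const (s + s) ℓ (tail bs)

BitDeg-∘ : ∀ {m n} s ℓ {F : F₂^ n → Vec Bool ℓ} {L : F₂^ m → F₂^ n} → Affine L →
           BitDeg s ℓ F → BitDeg s ℓ (F ∘ L)
BitDeg-∘ s zero _ _ = tt
BitDeg-∘ s (suc ℓ) {F} affine-L (d , ds) =
  Deg<-∘ (suc s) {head ∘ F} affine-L d , BitDeg-∘ (s + s) ℓ affine-L ds

BitDeg-addCarry : ∀ {n} s ℓ {c : F₂^ n → Bool} {F : F₂^ n → Vec Bool ℓ} → Deg s c → BitDeg s ℓ F →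
                  BitDeg s ℓ (λ y → addCarry (c y) (F y))
BitDeg-addCarry s zero _ _ = tt
BitDeg-addCarry s (suc ℓ) {c} {F} dc (d , ds) =
  Deg<-xor (suc s) {head ∘ F} {c} d dc ,
  BitDeg-addCarry (s + s) ℓ (Deg-∧ s s {c} {head ∘ F} dc d) ds

BitDeg-hamBits : ∀ n ℓ → BitDeg 1 ℓ (hamBits {n})
BitDeg-hamBits zero ℓ = BitDeg-cong 1 ℓ (λ { [] → refl }) (BitDeg-const 1 ℓ (replicate ℓ false))
BitDeg-hamBits (suc n) ℓ =
  BitDeg-cong 1 ℓ (λ { (_ ∷ _) → refl })
    (BitDeg-addCarry 1 ℓ {head} {hamBits ∘ tail} Deg-head
      (BitDeg-∘ 1 ℓ tail-affine (BitDeg-hamBits n ℓ)))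

matches : ∀ {ℓ} → Vec Bool ℓ → Vec Bool ℓ → Bool
matches [] _ = true
matches (w ∷ ws) bs = (not w xor head bs) ∧ matches ws (tail bs)

matches-refl : ∀ {ℓ} (w : Vec Bool ℓ) → matches w w ≡ true
matches-refl [] = refl
matches-refl (false ∷ w) = matches-refl w
matches-refl (true ∷ w) = matches-refl w

matches-sound : ∀ {ℓ} (w bs : Vec Bool ℓ) → matches w bs ≡ true → w ≡ bs
matches-sound [] [] _ = refl
matches-sound (false ∷ w) (false ∷ bs) eq = cong (false ∷_) (matches-sound w bs eq)
matches-sound (true ∷ w) (true ∷ bs) eq = cong (true ∷_) (matches-sound w bs eq)

bitDegSum : ℕ → ℕ → ℕ
bitDegSum s zero = 0
bitDegSum s (suc ℓ) = s + bitDegSum (s + s) ℓ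

bitDegSum-+ : ∀ s ℓ → bitDegSum s ℓ + s ≡ s * 2 ^ ℓ
bitDegSum-+ s zero = sym (*-identityʳ s)
bitDegSum-+ s (suc ℓ) = begin
  (s + t) + s      ≡⟨ trans (cong (_+ s) (+-comm s t)) (+-assoc t s s) ⟩
  t + (s + s)      ≡⟨ bitDegSum-+ (s + s) ℓ ⟩
  (s + s) * 2 ^ ℓ  ≡⟨ double-* s (2 ^ ℓ) ⟩
  s * 2 ^ suc ℓ    ∎
  where
  t = bitDegSum (s + s) ℓ
  double-* : ∀ s p → (s + s) * p ≡ s * (2 * p)
  double-* = solve-∀

Deg-matches : ∀ {n} s ℓ (w : Vec Bool ℓ) {F : F₂^ n → Vec Bool ℓ} → BitDeg s ℓ F →
              Deg (bitDegSum s ℓ) (λ y → matches w (F y))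
Deg-matches s zero [] _ = Deg-const 0 true
Deg-matches s (suc ℓ) (w ∷ ws) {F} (d , ds) =
  Deg-∧ s (bitDegSum (s + s) ℓ) {λ y → not w xor head (F y)} {λ y → matches ws (tail (F y))}
    (Deg<-xor (suc s) {λ _ → not w} {head ∘ F} (Deg-const s (not w)) d)
    (Deg-matches (s + s) ℓ ws ds)

Deg-matches-hamBits : ∀ {n} ℓ (w : Vec Bool ℓ) →
                      Deg (2 ^ ℓ ∸ 1) (λ (y : F₂^ n) → matches w (hamBits y))
Deg-matches-hamBits {n} ℓ w =
  subst (λ k → Deg k (λ (y : F₂^ n) → matches w (hamBits y))) bitDegSum-1
    (Deg-matches 1 ℓ w (BitDeg-hamBits n ℓ))
  where
  bitDegSum-1 : bitDegSum 1 ℓ ≡ 2 ^ ℓ ∸ 1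
  bitDegSum-1 =
    trans (sym (m+n∸n≡m _ 1)) (cong (_∸ 1) (trans (bitDegSum-+ 1 ℓ) (*-identityˡ _)))

inc : ∀ {ℓ} → Vec Bool ℓ → Vec Bool ℓ
inc = addCarry true

lowBits : (ℓ : ℕ) → ℕ → Vec Bool ℓ
lowBits ℓ = fold (replicate ℓ false) inc

hamBits≡lowBits∘Ham : ∀ {n} ℓ (y : F₂^ n) → hamBits y ≡ lowBits ℓ (Ham y)
hamBits≡lowBits∘Ham ℓ [] = refl
hamBits≡lowBits∘Ham ℓ (true ∷ y) = cong inc (hamBits≡lowBits∘Ham ℓ y)
hamBits≡lowBits∘Ham ℓ (false ∷ y) = trans (addCarry-false (hamBits y)) (hamBits≡lowBits∘Ham ℓ y)

inc-inc : ∀ {ℓ} b (bs : Vec Bool ℓ) → inc (inc (b ∷ bs)) ≡ b ∷ inc bs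
inc-inc true bs = cong (true ∷_) (addCarry-false (inc bs))
inc-inc false bs = cong (λ bs′ → false ∷ inc bs′) (addCarry-false bs)

inc^[m+m] : ∀ {ℓ} m b (bs : Vec Bool ℓ) → fold (b ∷ bs) inc (m + m) ≡ b ∷ fold bs inc m
inc^[m+m] zero b bs = refl
inc^[m+m] (suc m) b bs = begin
  fold (b ∷ bs) inc (suc m + suc m)      ≡⟨ cong (inc ∘ fold (b ∷ bs) inc) (+-suc m m) ⟩
  inc (inc (fold (b ∷ bs) inc (m + m)))  ≡⟨ cong (inc ∘ inc) (inc^[m+m] m b bs) ⟩
  inc (inc (b ∷ fold bs inc m))          ≡⟨ inc-inc b (fold bs inc m) ⟩
  b ∷ inc (fold bs inc m)                ∎

inc^2^ℓ : ∀ ℓ (bs : Vec Bool ℓ) → fold bs inc (2 ^ ℓ) ≡ bs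
inc^2^ℓ zero [] = refl
inc^2^ℓ (suc ℓ) (b ∷ bs) = begin
  fold (b ∷ bs) inc (2 ^ ℓ + (2 ^ ℓ + 0))  ≡⟨ cong (fold (b ∷ bs) inc ∘ (2 ^ ℓ +_)) (+-identityʳ _) ⟩
  fold (b ∷ bs) inc (2 ^ ℓ + 2 ^ ℓ)        ≡⟨ inc^[m+m] (2 ^ ℓ) b bs ⟩
  b ∷ fold bs inc (2 ^ ℓ)                  ≡⟨ cong (b ∷_) (inc^2^ℓ ℓ bs) ⟩
  b ∷ bs                                   ∎

inc^[k*2^ℓ] : ∀ ℓ k (bs : Vec Bool ℓ) → fold bs inc (k * 2 ^ ℓ) ≡ bs
inc^[k*2^ℓ] ℓ zero bs = refl
inc^[k*2^ℓ] ℓ (suc k) bs = begin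
  fold bs inc (2 ^ ℓ + k * 2 ^ ℓ)             ≡⟨ fold-+ bs inc (2 ^ ℓ) ⟩
  fold (fold bs inc (k * 2 ^ ℓ)) inc (2 ^ ℓ)  ≡⟨ cong (λ bs′ → fold bs′ inc (2 ^ ℓ)) (inc^[k*2^ℓ] ℓ k bs) ⟩
  fold bs inc (2 ^ ℓ)                         ≡⟨ inc^2^ℓ ℓ bs ⟩
  bs                                          ∎

lowBits-periodic : ∀ ℓ a k → lowBits ℓ (a + k * 2 ^ ℓ) ≡ lowBits ℓ a
lowBits-periodic ℓ a k =
  trans (fold-+ _ inc a) (cong (λ bs → fold bs inc a) (inc^[k*2^ℓ] ℓ k (replicate ℓ false)))

value : ∀ {ℓ} → Vec Bool ℓ → ℕ
value [] = 0
value (false ∷ bs) = 2 * value bs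
value (true ∷ bs) = suc (2 * value bs)

value-inc : ∀ {ℓ} (bs : Vec Bool ℓ) → value (inc bs) ≡ suc (value bs) ⊎ suc (value bs) ≡ 2 ^ ℓ
value-inc [] = inj₂ refl
value-inc (false ∷ bs) = inj₁ (cong (suc ∘ (2 *_) ∘ value) (addCarry-false bs))
value-inc (true ∷ bs) with value-inc bs
... | inj₁ no-overflow = inj₁ (trans (cong (2 *_) no-overflow) (*-suc 2 (value bs)))
... | inj₂ overflow = inj₂ (trans (sym (*-suc 2 (value bs))) (cong (2 *_) overflow))

value-lowBits : ∀ ℓ r → r < 2 ^ ℓ → value (lowBits ℓ r) ≡ r
value-lowBits ℓ zero _ = value-zeros ℓ
  where
  value-zeros : ∀ ℓ → value (replicate ℓ false) ≡ 0
  value-zeros zero = refl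
  value-zeros (suc ℓ) = cong (2 *_) (value-zeros ℓ)
value-lowBits ℓ (suc r) r+1<2^ℓ
  with value-inc (lowBits ℓ r) | value-lowBits ℓ r (<-trans (n<1+n r) r+1<2^ℓ)
... | inj₁ no-overflow | value-r = trans no-overflow (cong suc value-r)
... | inj₂ overflow    | value-r =
  ⊥-elim (<-irrefl (trans (cong suc (sym value-r)) overflow) r+1<2^ℓ)

m≡n+[m/o∸n/o]*o : ∀ m n o .{{_ : NonZero o}} → m % o ≡ n % o → n / o ≤ m / o →
                  m ≡ n + (m / o ∸ n / o) * o
m≡n+[m/o∸n/o]*o m n o m%o≡n%o n/o≤m/o = begin
  m                                          ≡⟨ m≡m%n+[m/n]*n m o ⟩
  m % o + m / o * o
    ≡⟨ cong₂ (λ r q → r + q * o) m%o≡n%o (sym (m+[n∸m]≡n n/o≤m/o)) ⟩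
  n % o + (n / o + (m / o ∸ n / o)) * o      ≡⟨ cong (n % o +_) (*-distribʳ-+ o (n / o) _) ⟩
  n % o + (n / o * o + (m / o ∸ n / o) * o)  ≡⟨ +-assoc (n % o) _ _ ⟨
  (n % o + n / o * o) + (m / o ∸ n / o) * o  ≡⟨ cong (_+ (m / o ∸ n / o) * o) (m≡m%n+[m/n]*n n o) ⟨
  n + (m / o ∸ n / o) * o                    ∎

%-≡⇒≡[mod] : ∀ m n o .{{_ : NonZero o}} → m % o ≡ n % o → m ≡ n [mod o ]
%-≡⇒≡[mod] m n o m%o≡n%o with ≤-total (n / o) (m / o)
... | inj₁ n/o≤m/o = inj₁ (m / o ∸ n / o , m≡n+[m/o∸n/o]*o m n o m%o≡n%o n/o≤m/o)
... | inj₂ m/o≤n/o = inj₂ (n / o ∸ m / o , m≡n+[m/o∸n/o]*o n m o (sym m%o≡n%o) m/o≤n/o)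

module _ (ℓ : ℕ) where
  private instance
    2^ℓ-nonZero : NonZero (2 ^ ℓ)
    2^ℓ-nonZero = m^n≢0 2 ℓ

  value-lowBits-% : ∀ N → value (lowBits ℓ N) ≡ N % 2 ^ ℓ
  value-lowBits-% N = begin
    value (lowBits ℓ N)
      ≡⟨ cong (value ∘ lowBits ℓ) (m≡m%n+[m/n]*n N (2 ^ ℓ)) ⟩
    value (lowBits ℓ (N % 2 ^ ℓ + N / 2 ^ ℓ * 2 ^ ℓ))
      ≡⟨ cong value (lowBits-periodic ℓ (N % 2 ^ ℓ) (N / 2 ^ ℓ)) ⟩
    value (lowBits ℓ (N % 2 ^ ℓ))
      ≡⟨ value-lowBits ℓ _ (m%n<n N (2 ^ ℓ)) ⟩
    N % 2 ^ ℓ ∎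

  lowBits≡⇒≡[mod] : ∀ N a → lowBits ℓ N ≡ lowBits ℓ a → N ≡ a [mod 2 ^ ℓ ]
  lowBits≡⇒≡[mod] N a eq = %-≡⇒≡[mod] N a (2 ^ ℓ)
    (trans (sym (value-lowBits-% N)) (trans (cong value eq) (value-lowBits-% a)))

≡[mod]⇒lowBits≡ : ∀ ℓ N a → N ≡ a [mod 2 ^ ℓ ] → lowBits ℓ N ≡ lowBits ℓ a
≡[mod]⇒lowBits≡ ℓ N a (inj₁ (k , N≡a+k2^ℓ)) =
  trans (cong (lowBits ℓ) N≡a+k2^ℓ) (lowBits-periodic ℓ a k)
≡[mod]⇒lowBits≡ ℓ N a (inj₂ (k , a≡N+k2^ℓ)) =
  sym (trans (cong (lowBits ℓ) a≡N+k2^ℓ) (lowBits-periodic ℓ N k))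

matches-hamBits⇒≡[mod] : ∀ {n} ℓ a (y : F₂^ n) →
                         matches (lowBits ℓ a) (hamBits y) ≡ true → Ham y ≡ a [mod 2 ^ ℓ ]
matches-hamBits⇒≡[mod] ℓ a y hit = lowBits≡⇒≡[mod] ℓ (Ham y) a
  (sym (trans (matches-sound _ _ hit) (hamBits≡lowBits∘Ham ℓ y)))

≡[mod]⇒matches-hamBits : ∀ {n} ℓ a (y : F₂^ n) →
                         Ham y ≡ a [mod 2 ^ ℓ ] → matches (lowBits ℓ a) (hamBits y) ≡ true
≡[mod]⇒matches-hamBits ℓ a y Hamy≡a =
  subst (λ bs → matches (lowBits ℓ a) bs ≡ true)
    (sym (trans (hamBits≡lowBits∘Ham ℓ y) (≡[mod]⇒lowBits≡ ℓ (Ham y) a Hamy≡a)))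
    (matches-refl (lowBits ℓ a))

proposition4p10 : (n ℓ : ℕ) → 1 ≤ n → 1 ≤ ℓ → (d : ℕ) → (C : AffineSubspace n d) → (a : ℕ) → a ≤ 2 ^ ℓ → UniqueResidue C (2 ^ ℓ) a → d ≤ 2 ^ ℓ ∸ 1
proposition4p10 n ℓ _ _ d C a _ (x₀ , ((c₀ , x₀≡point-c₀) , Hamx₀≡a) , only-x₀) =
  dim≤deg {f = hits} {base} {dirs} (Deg-matches-hamBits ℓ (lowBits ℓ a)) c₀ hits-c₀ only-c₀
  where
  open AffineSubspace C
  hits : F₂^ n → Bool
  hits y = matches (lowBits ℓ a) (hamBits y)
  hits-c₀ : hits (base ⊕ lincomb c₀ dirs) ≡ true
  hits-c₀ = ≡[mod]⇒matches-hamBits ℓ a (base ⊕ lincomb c₀ dirs)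
    (subst (λ x → Ham x ≡ a [mod 2 ^ ℓ ]) x₀≡point-c₀ Hamx₀≡a)
  only-c₀ : ∀ c → hits (base ⊕ lincomb c dirs) ≡ true → c ≡ c₀
  only-c₀ c hit = point-injective indep (trans
    (only-x₀ _ (c , refl) (matches-hamBits⇒≡[mod] ℓ a (base ⊕ lincomb c dirs) hit)) x₀≡point-c₀)
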